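{- Let $\mathbb{K}\in\{\mathbb{Z},\mathbb{Q}\}$, $d,n,\alpha\in\mathbb{N}$, $L$ an arbitrary set, $f,f^*\colon L\times\mathbb{Q}^d\to\mathbb{Q}$, and $c\colon L\to\mathbb{K}_n\setminus\{0\}$. If $f$ is $\alpha$-$\mathbb{K}$-linearizable and $f^*(x,w)=c(x)\cdot f(x,w)$ for all $x\in L$, $w\in\mathbb{Q}^d$, then $f^*$ is $n\alpha$-$\mathbb{K}$-linearizable.
   Context: For $r\in\mathbb{N}$ let $\mathbb{Z}_r=\{\pm p : p\in\{0,\dots,r\}\}$ and $\mathbb{Q}_r=\{\pm p/q : p\in\{0,\dots,r\},\ q\in\{1,\dots,r\}\}$. For $\mathbb{K}\in\{\mathbb{Z},\mathbb{Q}\}$ and $r,d\in\mathbb{N}$, two vectors $w,w'\in\mathbb{Q}^d$ are called $(r,\mathbb{K}^d)$-equivalent if for every $\beta\in\mathbb{K}_r^d$ with $\|\beta\|_1\le r$ one has $\mathrm{sign}(\beta^\top w)=\mathrm{sign}(\beta^\top w')$; write $[w]_r^{\mathbb{K}^d}$ for the set of all $w'\in\mathbb{Q}^d$ that are $(r,\mathbb{K}^d)$-equivalent to $w$. A function $f\colon L\times\mathbb{Q}^d\to\mathbb{Q}$ is $\alpha$-$\mathbb{K}$-linearizable ($\alpha\in\mathbb{N}$) if for all $w\in\mathbb{Q}^d$ and all $x\in L$ there exists $b_{x,w}\in\mathbb{K}_\alpha^d$ with $\|b_{x,w}\|_1\le\alpha$ such that $f(x,w')=b_{x,w}^\top w'$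 for all $w'\in[w]_\alpha^{\mathbb{K}^d}$. -}

module Defs where

open import Data.Nat as ℕ using (ℕ; suc)
open import Data.Integer as ℤ using (+_)
open import Data.Rational using (ℚ; _/_; 0ℚ; _+_; _*_; _≤_; ∣_∣; -_)
open import Data.Rational.Properties using (<-cmp)
open import Data.Fin using (Fin)
open import Data.Vec.Functional using (Vector; foldr; zipWith)
open import Data.Product using (Σ; ∃; _×_; ∃-syntax)
open import Data.Sum using (_⊎_)
open import Relation.Binary.PropositionalEquality using (_≡_; _≢_)
open import Relation.Binary.Definitions using (tri<; tri≈; tri>)

data 𝕂 : Set where
  ZZ QQ : 𝕂

ℕtoℚ : ℕ → ℚ
ℕtoℚ r = + r / 1

In𝕂 : 𝕂 → ℕ → ℚ → Set
In𝕂 ZZ r x = ∃[ p ] (p ℕ.≤ r × (x ≡ + p / 1 ⊎ x ≡ - (+ p / 1)))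
In𝕂 QQ r x = ∃[ p ] ∃[ k ] (p ℕ.≤ r × suc k ℕ.≤ r ×
               (x ≡ + p / suc k ⊎ x ≡ - (+ p / suc k)))

In𝕂ᵈ : 𝕂 → ℕ → {d : ℕ} → Vector ℚ d → Set
In𝕂ᵈ K r β = ∀ i → In𝕂 K r (β i)

dot : {d : ℕ} → Vector ℚ d → Vector ℚ d → ℚ
dot β w = foldr _+_ 0ℚ (zipWith _*_ β w)

norm1 : {d : ℕ} → Vector ℚ d → ℚ
norm1 β = foldr _+_ 0ℚ (λ i → ∣ β i ∣)

data Sign : Set where
  neg zer pos : Sign

sign : ℚ → Sign
sign q with <-cmp q 0ℚ
... | tri< _ _ _ = neg
... | tri≈ _ _ _ = zer
... | tri> _ _ _ = pos

Equiv : 𝕂 → ℕ → {d : ℕ} → Vector ℚ d → Vector ℚ d → Set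
Equiv K r {d} w w' = (β : Vector ℚ d) → In𝕂ᵈ K r β → norm1 β ≤ ℕtoℚ r →
                     sign (dot β w) ≡ sign (dot β w')

Linearizable : 𝕂 → ℕ → {d : ℕ} {L : Set} → (L → Vector ℚ d → ℚ) → Set
Linearizable K α {d} {L} f =
  (w : Vector ℚ d) (x : L) →
  Σ (Vector ℚ d) λ b → In𝕂ᵈ K α b × norm1 b ≤ ℕtoℚ α ×
    ((w' : Vector ℚ d) → Equiv K α w w' → f x w' ≡ dot b w')

-- A linearization b of f at w also linearizes c x · f at w once it is scaled to c x · b:
-- the entries of c x · b are products of an element of 𝕂_n and one of 𝕂_α, hence lie in
-- 𝕂_{nα}, and ‖c x · b‖₁ = |c x| ‖b‖₁ ≤ nα.  Since c x ≠ 0 forces n ≥ 1, the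
-- (nα)-equivalence class of w is contained in its α-equivalence class, on which b is valid.
module Submission where

open import Defs
open import Data.Nat using (ℕ; _*_)
open import Data.Rational using (ℚ; 0ℚ) renaming (_*_ to _*ℚ_)
open import Data.Vec.Functional using (Vector)
open import Relation.Binary.PropositionalEquality using (_≡_; _≢_)

import Data.Nat as ℕ
import Data.Nat.Properties as ℕ
import Data.Integer as ℤ
import Data.Integer.Properties as ℤ
import Data.Rational.Unnormalised as ℚᵘ
import Data.Rational.Unnormalised.Properties as ℚᵘ
open import Data.Rational
  using (_/_; -_; ∣_∣; _+_; _≤_; toℚᵘ; fromℚᵘ)
open import Data.Rational.Properties
open import Algebra.Properties.Ring +-*-ring using (-‿involutive)
open import Data.Fin using (zero; suc)
open import Data.Vec.Functional using (map)
open import Data.Product using (_,_)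
open import Data.Sum using (_⊎_; inj₁; inj₂)
open import Data.Empty using (⊥-elim)
open import Relation.Binary.PropositionalEquality
  using (refl; sym; trans; cong; cong₂; subst; module ≡-Reasoning)

fromℚᵘ-homo-* : ∀ p q → fromℚᵘ (p ℚᵘ.* q) ≡ fromℚᵘ p *ℚ fromℚᵘ q
fromℚᵘ-homo-* p q = begin
  fromℚᵘ (p ℚᵘ.* q)                               ≡⟨ fromℚᵘ-cong (ℚᵘ.*-cong (ℚᵘ.≃-sym (toℚᵘ-fromℚᵘ p)) (ℚᵘ.≃-sym (toℚᵘ-fromℚᵘ q))) ⟩
  fromℚᵘ (toℚᵘ (fromℚᵘ p) ℚᵘ.* toℚᵘ (fromℚᵘ q))   ≡⟨ fromℚᵘ-cong (ℚᵘ.≃-sym (toℚᵘ-homo-* (fromℚᵘ p) (fromℚᵘ q))) ⟩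
  fromℚᵘ (toℚᵘ (fromℚᵘ p *ℚ fromℚᵘ q))            ≡⟨ fromℚᵘ-toℚᵘ _ ⟩
  fromℚᵘ p *ℚ fromℚᵘ q                            ∎
  where open ≡-Reasoning

/-*-/ : ∀ i j a b → (i / ℕ.suc a) *ℚ (j / ℕ.suc b) ≡ (i ℤ.* j) / (ℕ.suc a * ℕ.suc b)
/-*-/ i j a b = sym (fromℚᵘ-homo-* (ℚᵘ.mkℚᵘ i a) (ℚᵘ.mkℚᵘ j b))

*≤*⇒/≤/ : ∀ i j a b → i ℤ.* ℤ.+ ℕ.suc b ℤ.≤ j ℤ.* ℤ.+ ℕ.suc a →
           i / ℕ.suc a ≤ j / ℕ.suc b
*≤*⇒/≤/ i j a b cross = toℚᵘ-cancel-≤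
  (ℚᵘ.≤-respˡ-≃ (ℚᵘ.≃-sym (toℚᵘ-fromℚᵘ (ℚᵘ.mkℚᵘ i a)))
  (ℚᵘ.≤-respʳ-≃ (ℚᵘ.≃-sym (toℚᵘ-fromℚᵘ (ℚᵘ.mkℚᵘ j b)))
    (ℚᵘ.*≤* cross)))

ℕtoℚ-mono-≤ : ∀ {m n} → m ℕ.≤ n → ℕtoℚ m ≤ ℕtoℚ n
ℕtoℚ-mono-≤ {m} {n} m≤n = *≤*⇒/≤/ (ℤ.+ m) (ℤ.+ n) 0 0 (ℤ.*-monoʳ-≤-nonNeg (ℤ.+ 1) (ℤ.+≤+ m≤n))

ℕtoℚ-homo-* : ∀ m n → ℕtoℚ m *ℚ ℕtoℚ n ≡ ℕtoℚ (m * n)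
ℕtoℚ-homo-* m n = trans (/-*-/ (ℤ.+ m) (ℤ.+ n) 0 0) (cong (_/ 1) (sym (ℤ.pos-* m n)))

+/suc≤ℕtoℚ : ∀ p k → ℤ.+ p / ℕ.suc k ≤ ℕtoℚ p
+/suc≤ℕtoℚ p k = *≤*⇒/≤/ (ℤ.+ p) (ℤ.+ p) k 0 (ℤ.*-monoˡ-≤-nonNeg (ℤ.+ p) (ℤ.+≤+ (ℕ.s≤s ℕ.z≤n)))

infix 4 _≡±_

_≡±_ : ℚ → ℚ → Set
x ≡± y = x ≡ y ⊎ x ≡ - y

≡±-* : ∀ {x y u v} → x ≡± u → y ≡± v → x *ℚ y ≡± u *ℚ v
≡±-* (inj₁ refl) (inj₁ refl) = inj₁ refl
≡±-* {u = u} {v} (inj₁ refl) (inj₂ refl) = inj₂ (sym (neg-distribʳ-* u v))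
≡±-* {u = u} {v} (inj₂ refl) (inj₁ refl) = inj₂ (sym (neg-distribˡ-* u v))
≡±-* {u = u} {v} (inj₂ refl) (inj₂ refl) = inj₁ (begin
  - u *ℚ - v     ≡⟨ neg-distribʳ-* (- u) v ⟨
  - (- u *ℚ v)   ≡⟨ cong -_ (neg-distribˡ-* u v) ⟨
  - - (u *ℚ v)   ≡⟨ -‿involutive (u *ℚ v) ⟩
  u *ℚ v         ∎)
  where open ≡-Reasoning

≡±-resp-≡ : ∀ {x u v} → u ≡ v → x ≡± u → x ≡± v
≡±-resp-≡ refl x≡±u = x≡±u

≡±⇒∣∣≡ : ∀ {x u} → x ≡± u → ∣ x ∣ ≡ ∣ u ∣
≡±⇒∣∣≡ (inj₁ refl) = refl
≡±⇒∣∣≡ {u = u} (inj₂ refl) = ∣-p∣≡∣p∣ u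

∣+/suc∣≡ : ∀ p k → ∣ ℤ.+ p / ℕ.suc k ∣ ≡ ℤ.+ p / ℕ.suc k
∣+/suc∣≡ p k = 0≤p⇒∣p∣≡p (nonNegative⁻¹ _ {{normalize-nonNeg p (ℕ.suc k)}})

In𝕂-mono : ∀ K {r s} x → r ℕ.≤ s → In𝕂 K r x → In𝕂 K s x
In𝕂-mono ZZ x r≤s (p , p≤r , x≡±p) = p , ℕ.≤-trans p≤r r≤s , x≡±p
In𝕂-mono QQ x r≤s (p , k , p≤r , 1+k≤r , x≡±p/q) =
  p , k , ℕ.≤-trans p≤r r≤s , ℕ.≤-trans 1+k≤r r≤s , x≡±p/q

In𝕂-* : ∀ K {r s} x y → In𝕂 K r x → In𝕂 K s y → In𝕂 K (r * s) (x *ℚ y)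
In𝕂-* ZZ x y (p , p≤r , x≡±p) (q , q≤s , y≡±q) =
  p * q , ℕ.*-mono-≤ p≤r q≤s ,
  ≡±-resp-≡ (ℕtoℚ-homo-* p q) (≡±-* x≡±p y≡±q)
In𝕂-* QQ x y (p , k , p≤r , 1+k≤r , x≡±p/k) (q , m , q≤s , 1+m≤s , y≡±q/m) =
  p * q , m ℕ.+ k * ℕ.suc m , ℕ.*-mono-≤ p≤r q≤s , ℕ.*-mono-≤ 1+k≤r 1+m≤s ,
  ≡±-resp-≡ (trans (/-*-/ (ℤ.+ p) (ℤ.+ q) k m) (cong (_/ _) (sym (ℤ.pos-* p q))))
            (≡±-* x≡±p/k y≡±q/m)

In𝕂⇒∣∣≤ : ∀ K {r} x → In𝕂 K r x → ∣ x ∣ ≤ ℕtoℚ r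
In𝕂⇒∣∣≤ ZZ {r} x (p , p≤r , x≡±p) =
  subst (_≤ ℕtoℚ r) (sym (trans (≡±⇒∣∣≡ x≡±p) (∣+/suc∣≡ p 0))) (ℕtoℚ-mono-≤ p≤r)
In𝕂⇒∣∣≤ QQ {r} x (p , k , p≤r , _ , x≡±p/k) =
  subst (_≤ ℕtoℚ r) (sym (trans (≡±⇒∣∣≡ x≡±p/k) (∣+/suc∣≡ p k)))
        (≤-trans (+/suc≤ℕtoℚ p k) (ℕtoℚ-mono-≤ p≤r))

-- 𝕂_0 = {0}: ℤ_0 contains only ±0, and ℚ_0 has no admissible denominator.
In𝕂-≢0⇒nonZero : ∀ K {r} x → In𝕂 K r x → x ≢ 0ℚ → ℕ.NonZero r
In𝕂-≢0⇒nonZero ZZ {ℕ.zero} x (.0 , ℕ.z≤n , inj₁ x≡0) x≢0 = ⊥-elim (x≢0 x≡0)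
In𝕂-≢0⇒nonZero ZZ {ℕ.zero} x (.0 , ℕ.z≤n , inj₂ x≡0) x≢0 = ⊥-elim (x≢0 x≡0)
In𝕂-≢0⇒nonZero ZZ {ℕ.suc r} x _ _ = _
In𝕂-≢0⇒nonZero QQ x (_ , _ , _ , 1+k≤r , _) _ = ℕ.>-nonZero (ℕ.≤-trans (ℕ.s≤s ℕ.z≤n) 1+k≤r)

Equiv-antimono : ∀ K {r s d} {w w' : Vector ℚ d} → r ℕ.≤ s → Equiv K s w w' → Equiv K r w w'
Equiv-antimono K r≤s w≈w' β β∈𝕂 ‖β‖≤r =
  w≈w' β (λ i → In𝕂-mono K (β i) r≤s (β∈𝕂 i)) (≤-trans ‖β‖≤r (ℕtoℚ-mono-≤ r≤s))

dot-*ˡ : ∀ {d} c (b w : Vector ℚ d) → dot (map (c *ℚ_) b) w ≡ c *ℚ dot b w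
dot-*ˡ {ℕ.zero} c b w = sym (*-zeroʳ c)
dot-*ˡ {ℕ.suc d} c b w = trans
  (cong₂ _+_ (*-assoc c (b zero) (w zero)) (dot-*ˡ c (λ i → b (suc i)) (λ i → w (suc i))))
  (sym (*-distribˡ-+ c _ _))

norm1-*ˡ : ∀ {d} c (b : Vector ℚ d) → norm1 (map (c *ℚ_) b) ≡ ∣ c ∣ *ℚ norm1 b
norm1-*ˡ {ℕ.zero} c b = sym (*-zeroʳ ∣ c ∣)
norm1-*ˡ {ℕ.suc d} c b = trans
  (cong₂ _+_ (∣p*q∣≡∣p∣*∣q∣ c (b zero)) (norm1-*ˡ c (λ i → b (suc i))))
  (sym (*-distribˡ-+ ∣ c ∣ _ _))

norm1-*ˡ-≤ : ∀ K {n α d} c (b : Vector ℚ d) → In𝕂 K n c → norm1 b ≤ ℕtoℚ α →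
             norm1 (map (c *ℚ_) b) ≤ ℕtoℚ (n * α)
norm1-*ˡ-≤ K {n} {α} c b c∈𝕂 ‖b‖≤α = begin
  norm1 (map (c *ℚ_) b)  ≡⟨ norm1-*ˡ c b ⟩
  ∣ c ∣ *ℚ norm1 b       ≤⟨ *-monoˡ-≤-nonNeg ∣ c ∣ {{∣-∣-nonNeg c}} ‖b‖≤α ⟩
  ∣ c ∣ *ℚ ℕtoℚ α        ≤⟨ *-monoʳ-≤-nonNeg (ℕtoℚ α) {{normalize-nonNeg α 1}} (In𝕂⇒∣∣≤ K c c∈𝕂) ⟩
  ℕtoℚ n *ℚ ℕtoℚ α       ≡⟨ ℕtoℚ-homo-* n α ⟩
  ℕtoℚ (n * α)           ∎
  where open ≤-Reasoning

lemma18 : (K : 𝕂) (d n α : ℕ) (L : Set)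
          (f f* : L → Vector ℚ d → ℚ) (c : L → ℚ) →
          ((x : L) → In𝕂 K n (c x)) → ((x : L) → c x ≢ 0ℚ) →
          Linearizable K α f →
          ((x : L) (w : Vector ℚ d) → f* x w ≡ c x *ℚ f x w) →
          Linearizable K (n * α) f*
lemma18 K d n α L f f* c c∈𝕂 c≢0 f-lin f*≡cf w x
  with f-lin w x
... | b , b∈𝕂 , ‖b‖≤α , f≡b =
  map (c x *ℚ_) b ,
  (λ i → In𝕂-* K (c x) (b i) (c∈𝕂 x) (b∈𝕂 i)) ,
  norm1-*ˡ-≤ K (c x) b (c∈𝕂 x) ‖b‖≤α ,
  λ w' w≈w' → begin
    f* x w'                      ≡⟨ f*≡cf x w' ⟩
    c x *ℚ f x w'                ≡⟨ cong (c x *ℚ_) (f≡b w' (Equiv-antimono K α≤nα w≈w')) ⟩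
    c x *ℚ dot b w'              ≡⟨ dot-*ˡ (c x) b w' ⟨
    dot (map (c x *ℚ_) b) w'     ∎
  where
  open ≡-Reasoning
  α≤nα : α ℕ.≤ n * α
  α≤nα = ℕ.m≤n*m α n {{In𝕂-≢0⇒nonZero K (c x) (c∈𝕂 x) (c≢0 x)}}
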